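{- Let $p,q$ be positive integers with $pq>2p+q$. Let $H_{p,q}$ be the bipartite multigraph with vertex set $\{x,y_1,\dots,y_q,z\}$ in which, for each $i=1,\dots,q$, the vertices $x$ and $y_i$ are joined by $p$ parallel edges and $y_i$ and $z$ are joined by a single edge, and there are no other edges. Then $H_{p,q}$ has no cyclic interval $t$-coloring for any positive integer $t$.
   Context: Graphs are finite and undirected; multiple edges are allowed, loops are not. A proper $t$-edge coloring of $G$ is a map $\alpha:E(G)\to\{1,\dots,t\}$ with $\alpha(e)\neq\alpha(e')$ for any two distinct edges $e,e'$ sharing an endpoint (in particular parallel edges get distinct colors); $S(v,\alpha)$ is the set of colors on edges incident to $v$. A proper $t$-edge coloring $\alpha$ is a cyclic interval $t$-coloring if for every vertex $v$, either $S(v,\alpha)$ or $\{1,\dots,t\}\setminus S(v,\alpha)$ is a set of consecutive integers. -}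

module Defs where

open import Data.Nat using (ℕ; _≤_; _<_)
open import Data.Fin using (Fin)
open import Data.Product using (Σ; ∃; _×_; _,_; proj₁; proj₂)
open import Data.Sum using (_⊎_; inj₁; inj₂)
open import Relation.Nullary using (¬_)
open import Relation.Binary.PropositionalEquality using (_≡_; _≢_)
open import Function.Bundles using (_⇔_)

-- A multigraph: a vertex type, an edge type, and for each edge its two
-- endpoints (distinct: no loops). Parallel edges = distinct edges with the
-- same endpoints.
record Multigraph : Set₁ where
  field
    V     : Set
    E     : Set
    end₁  : E → V
    end₂  : E → V
    loopless : ∀ e → end₁ e ≢ end₂ e

open Multigraph public

Incident : (G : Multigraph) → E G → V G → Set
Incident G e v = (end₁ G e ≡ v) ⊎ (end₂ G e ≡ v)

ProperEdgeColoring : (G : Multigraph) → ℕ → (E G → ℕ) → Set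
ProperEdgeColoring G t α =
  (∀ e → 1 ≤ α e × α e ≤ t) ×
  (∀ e e' v → e ≢ e' → Incident G e v → Incident G e' v → α e ≢ α e')

S : (G : Multigraph) → V G → (E G → ℕ) → ℕ → Set
S G v α c = ∃ λ e → Incident G e v × α e ≡ c

Sᶜ : (G : Multigraph) → ℕ → V G → (E G → ℕ) → ℕ → Set
Sᶜ G t v α c = (1 ≤ c × c ≤ t) × ¬ S G v α c

Consecutive : (ℕ → Set) → Set
Consecutive P =
  (∀ c → ¬ P c) ⊎
  (Σ ℕ λ a → Σ ℕ λ b → ∀ c → P c ⇔ (a ≤ c × c ≤ b))

CyclicIntervalColoring : (G : Multigraph) → ℕ → (E G → ℕ) → Set
CyclicIntervalColoring G t α =
  ProperEdgeColoring G t α ×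
  (∀ v → Consecutive (S G v α) ⊎ Consecutive (Sᶜ G t v α))

data HV (q : ℕ) : Set where
  x : HV q
  y : Fin q → HV q
  z : HV q

-- edges: inj₁ (i , k) is the k-th of the p parallel edges x y_i;
--        inj₂ i is the edge y_i z
HE : ℕ → ℕ → Set
HE p q = (Fin q × Fin p) ⊎ Fin q

H-end₁ : ∀ p q → HE p q → HV q
H-end₁ p q (inj₁ _) = x
H-end₁ p q (inj₂ i) = y i

H-end₂ : ∀ p q → HE p q → HV q
H-end₂ p q (inj₁ (i , _)) = y i
H-end₂ p q (inj₂ _) = z

H-loopless : ∀ p q e → H-end₁ p q e ≢ H-end₂ p q e
H-loopless p q (inj₁ _) ()
H-loopless p q (inj₂ _) ()

H : ℕ → ℕ → Multigraph
H p q = record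
  { V = HV q ; E = HE p q
  ; end₁ = H-end₁ p q ; end₂ = H-end₂ p q
  ; loopless = H-loopless p q }

-- Read colours modulo t. At a vertex of degree d, either the colours or their complement in
-- {1,…,t} form an interval, so the colours occupy a cyclic window of at most d consecutive
-- residues. The windows at y_i (length p + 1) and at z (length q) share the residue of the edge
-- y_i z, so every colour at x lies within cyclic distance p of the window at z. Hence the pq
-- colours at x, which are distinct residues, fit into 2p + q consecutive residues.
module Submission where

open import Defs
open import Data.Nat using (ℕ; zero; suc; _+_; _*_; _∸_; _≤_; _<_; z≤n; s≤s; s≤s⁻¹; _≤?_; _<?_; _≟_)
open import Data.Nat.Properties
open import Data.Nat.Tactic.RingSolver using (solve-∀)
open import Data.Fin using (Fin; toℕ; fromℕ<; remQuot) renaming (zero to fzero; suc to fsuc)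
import Data.Fin.Properties as Fin
open import Data.Product using (∃; ∃₂; _×_; _,_; proj₁; proj₂)
import Data.Product.Properties as Product
open import Data.Sum using (_⊎_; inj₁; inj₂)
import Data.Sum.Properties as Sum
open import Relation.Nullary using (¬_; yes; no; contradiction)
open import Relation.Nullary.Decidable using (decidable-stable; map′)
open import Relation.Binary.Definitions using (DecidableEquality)
open import Relation.Binary.PropositionalEquality
open import Function using (_∘_)
open import Function.Bundles using (_⇔_; mk⇔; Equivalence; Injection)
open import Function.Definitions using (Injective)
open import Function.Properties.Inverse using (↔⇒↣)

infix 4 _≡_mod_

_≡_mod_ : ℕ → ℕ → ℕ → Set
_≡_mod_ a b t = ∃₂ λ s s' → a + s * t ≡ b + s' * t

module _ {t : ℕ} where

  ≡⇒≡-mod : ∀ {a b} → a ≡ b → a ≡ b mod t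
  ≡⇒≡-mod refl = 0 , 0 , refl

  mod-refl : ∀ {a} → a ≡ a mod t
  mod-refl = ≡⇒≡-mod refl

  mod-sym : ∀ {a b} → a ≡ b mod t → b ≡ a mod t
  mod-sym (s , s' , eq) = s' , s , sym eq

  mod-trans : ∀ {a b c} → a ≡ b mod t → b ≡ c mod t → a ≡ c mod t
  mod-trans {a} {b} {c} (s₁ , s₂ , eq₁) (s₃ , s₄ , eq₂) = s₁ + s₃ , s₄ + s₂ , (begin
    a + (s₁ + s₃) * t      ≡⟨ regroup a s₁ s₃ t ⟩
    (a + s₁ * t) + s₃ * t  ≡⟨ cong (_+ s₃ * t) eq₁ ⟩
    (b + s₂ * t) + s₃ * t  ≡⟨ swap b s₂ s₃ t ⟩
    (b + s₃ * t) + s₂ * t  ≡⟨ cong (_+ s₂ * t) eq₂ ⟩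
    (c + s₄ * t) + s₂ * t  ≡⟨ regroup c s₄ s₂ t ⟨
    c + (s₄ + s₂) * t      ∎)
    where
    open ≡-Reasoning
    regroup : ∀ a s s' t → a + (s + s') * t ≡ (a + s * t) + s' * t
    regroup = solve-∀
    swap : ∀ a s s' t → (a + s * t) + s' * t ≡ (a + s' * t) + s * t
    swap = solve-∀

  mod-+ : ∀ {a b c d} → a ≡ b mod t → c ≡ d mod t → a + c ≡ b + d mod t
  mod-+ {a} {b} {c} {d} (s₁ , s₂ , eq₁) (s₃ , s₄ , eq₂) = s₁ + s₃ , s₂ + s₄ , (begin
    a + c + (s₁ + s₃) * t          ≡⟨ interchange a c s₁ s₃ t ⟩
    (a + s₁ * t) + (c + s₃ * t)    ≡⟨ cong₂ _+_ eq₁ eq₂ ⟩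
    (b + s₂ * t) + (d + s₄ * t)    ≡⟨ interchange b d s₂ s₄ t ⟨
    b + d + (s₂ + s₄) * t          ∎)
    where
    open ≡-Reasoning
    interchange : ∀ a c s s' t → a + c + (s + s') * t ≡ (a + s * t) + (c + s' * t)
    interchange = solve-∀

  +-cancelˡ-mod : ∀ o {a b} → o + a ≡ o + b mod t → a ≡ b mod t
  +-cancelˡ-mod o {a} {b} (s , s' , eq) =
    s , s' , +-cancelˡ-≡ o _ _ (trans (sym (+-assoc o a (s * t))) (trans eq (+-assoc o b (s' * t))))

  +t≡-mod : ∀ a → a + t ≡ a mod t
  +t≡-mod a = 0 , 1 , trans (+-identityʳ (a + t)) (cong (a +_) (sym (+-identityʳ t)))

  ≡-mod⇒≡ : ∀ {o a b} → o ≤ a → a < o + t → o ≤ b → b < o + t → a ≡ b mod t → a ≡ b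
  ≡-mod⇒≡ {o} {a} {b} o≤a a<o+t o≤b b<o+t (s , s' , a+st≡b+s't) = cancel s s' a+st≡b+s't
    where
    below : ∀ {u v} → o ≤ v → u < o + t → ∀ s → u < v + suc s * t
    below o≤v u<o+t s = <-≤-trans u<o+t (+-mono-≤ o≤v (m≤m+n t (s * t)))
    unfold : ∀ u s t → u + suc s * t ≡ t + (u + s * t)
    unfold = solve-∀
    cancel : ∀ s s' → a + s * t ≡ b + s' * t → a ≡ b
    cancel zero     zero      eq = trans (sym (+-identityʳ a)) (trans eq (+-identityʳ b))
    cancel zero     (suc s')  eq = contradiction (trans (sym (+-identityʳ a)) eq) (<⇒≢ (below o≤b a<o+t s'))
    cancel (suc s)  zero      eq = contradiction (trans (sym (+-identityʳ b)) (sym eq)) (<⇒≢ (below o≤a b<o+t s))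
    cancel (suc s)  (suc s')  eq =
      cancel s s' (+-cancelˡ-≡ t _ _ (trans (sym (unfold a s t)) (trans eq (unfold b s' t))))

InWindow : (t o n u : ℕ) → Set
InWindow t o n u = ∃ λ k → k < n × u ≡ o + k mod t

module _ {t : ℕ} where

  inWindow : ∀ {o n u v} → o ≤ v → v < o + n → u ≡ v mod t → InWindow t o n u
  inWindow {o} {n} {v = v} o≤v v<o+n u≡v =
    v ∸ o , +-cancelˡ-< o _ n (subst (_< o + n) (sym o+[v∸o]≡v) v<o+n) ,
    mod-trans u≡v (≡⇒≡-mod (sym o+[v∸o]≡v))
    where
    o+[v∸o]≡v : o + (v ∸ o) ≡ v
    o+[v∸o]≡v = m+[n∸m]≡n o≤v

  inWindow-resp : ∀ {o n u v} → u ≡ v mod t → InWindow t o n v → InWindow t o n u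
  inWindow-resp u≡v (k , k<n , v≡o+k) = k , k<n , mod-trans u≡v v≡o+k

  window-diff : ∀ {o p a c} → InWindow t o (suc p) a → InWindow t o (suc p) c →
                ∃ λ d → d ≤ p + p × p + a ≡ c + d mod t
  window-diff {o} {p} {a} {c} (k₁ , k₁<1+p , a≡o+k₁) (k₂ , k₂<1+p , c≡o+k₂) =
    k₁ + (p ∸ k₂) , +-mono-≤ (s≤s⁻¹ k₁<1+p) (m∸n≤m p k₂) ,
    mod-trans (mod-+ mod-refl a≡o+k₁)
      (mod-trans (≡⇒≡-mod regroup) (mod-+ (mod-sym c≡o+k₂) mod-refl))
    where
    rearrange : ∀ o k₁ k₂ r → (k₂ + r) + (o + k₁) ≡ (o + k₂) + (k₁ + r)
    rearrange = solve-∀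
    regroup : p + (o + k₁) ≡ (o + k₂) + (k₁ + (p ∸ k₂))
    regroup = trans (cong (_+ (o + k₁)) (sym (m+[n∸m]≡n (s≤s⁻¹ k₂<1+p))))
                    (rearrange o k₁ k₂ (p ∸ k₂))

  window-shift : ∀ {o q r c d} → InWindow t o q c → d ≤ r → InWindow t o (r + q) (c + d)
  window-shift {o} {d = d} (k , k<q , c≡o+k) d≤r =
    d + k , +-mono-≤-< d≤r k<q ,
    mod-trans (mod-+ c≡o+k mod-refl) (≡⇒≡-mod (trans (+-assoc o k d) (cong (o +_) (+-comm k d))))

  path-window : ∀ {o o' p q a c} → InWindow t o (suc p) a → InWindow t o (suc p) c →
                InWindow t o' q c → InWindow t o' (p + p + q) (p + a)
  path-window a∈W c∈W c∈W' =
    let d , d≤2p , p+a≡c+d = window-diff a∈W c∈W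
    in inWindow-resp p+a≡c+d (window-shift c∈W' d≤2p)

  window-capacity : ∀ {d o m} (f : Fin d → ℕ) → (∀ {i i'} → f i ≡ f i' mod t → i ≡ i') →
                    (∀ i → InWindow t o m (f i)) → d ≤ m
  window-capacity {d} {o} {m} f residues-distinct f∈W = Fin.injective⇒≤ slot-injective
    where
    offset : Fin d → ℕ
    offset i = proj₁ (f∈W i)
    slot : Fin d → Fin m
    slot i = fromℕ< (proj₁ (proj₂ (f∈W i)))
    slot-injective : Injective _≡_ _≡_ slot
    slot-injective {i} {i'} eq = residues-distinct
      (mod-trans (proj₂ (proj₂ (f∈W i)))
        (subst (λ k → o + k ≡ f i' mod t) (sym offset-eq) (mod-sym (proj₂ (proj₂ (f∈W i'))))))
      where
      offset-eq : offset i ≡ offset i'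
      offset-eq = trans (sym (Fin.toℕ-fromℕ< _)) (trans (cong toℕ eq) (Fin.toℕ-fromℕ< _))

  covered-length-≤ : ∀ {n o L} (g : Fin n → ℕ) → L ≤ t →
                     (∀ k → k < L → ∃ λ j → g j ≡ o + k mod t) → L ≤ n
  covered-length-≤ {n} {o} {L} g L≤t cover = Fin.injective⇒≤ hit-injective
    where
    hit : Fin L → Fin n
    hit i = proj₁ (cover (toℕ i) (Fin.toℕ<n i))
    hits : ∀ i → g (hit i) ≡ o + toℕ i mod t
    hits i = proj₂ (cover (toℕ i) (Fin.toℕ<n i))
    <t : ∀ (i : Fin L) → toℕ i < t
    <t i = <-≤-trans (Fin.toℕ<n i) L≤t
    hit-injective : Injective _≡_ _≡_ hit
    hit-injective {i} {i'} eq = Fin.toℕ-injective (≡-mod⇒≡ z≤n (<t i) z≤n (<t i')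
      (+-cancelˡ-mod o (mod-trans (mod-sym (hits i))
        (subst (λ j → g j ≡ o + toℕ i' mod t) (sym eq) (hits i')))))

module ColourWindow {t n : ℕ} (g : Fin n → ℕ) (g-range : ∀ j → 1 ≤ g j × g j ≤ t)
                    (P : ℕ → Set) (P⇔image : ∀ c → P c ⇔ ∃ λ j → g j ≡ c) where

  open Equivalence

  Window : Set
  Window = ∃ λ o → ∀ j → InWindow t o n (g j)

  P-range : ∀ {c} → P c → 1 ≤ c × c ≤ t
  P-range {c} Pc = let j , gj≡c = to (P⇔image c) Pc in subst (λ c → 1 ≤ c × c ≤ t) gj≡c (g-range j)

  P-stable : ∀ {c} → ¬ ¬ P c → P c
  P-stable {c} = decidable-stable (map′ (from (P⇔image c)) (to (P⇔image c)) (Fin.any? λ j → g j ≟ c))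

  window-of-cover : ∀ {o L} → L ≤ t → (∀ j → InWindow t o L (g j)) →
                    (∀ k → k < L → ∃ λ c → P c × c ≡ o + k mod t) → Window
  window-of-cover {o} {L} L≤t g∈W cover = o , λ j →
    let k , k<L , gj≡o+k = g∈W j in k , <-≤-trans k<L L≤n , gj≡o+k
    where
    hit : ∀ k → k < L → ∃ λ j → g j ≡ o + k mod t
    hit k k<L = let c , Pc , c≡o+k = cover k k<L
                    j , gj≡c = to (P⇔image c) Pc
                in j , subst (λ c → c ≡ o + k mod t) (sym gj≡c) c≡o+k
    L≤n : L ≤ n
    L≤n = covered-length-≤ g L≤t hit

  empty-window : (∀ c → ¬ P c) → Window
  empty-window ∅ = 0 , λ j → contradiction (from (P⇔image (g j)) (j , refl)) (∅ (g j))

  interval-window : ∀ a b → (∀ c → P c ⇔ (a ≤ c × c ≤ b)) → Window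
  interval-window a b P⇔[a,b] with a ≤? b
  ... | no a≰b = empty-window λ c Pc → let a≤c , c≤b = to (P⇔[a,b] c) Pc in a≰b (≤-trans a≤c c≤b)
  ... | yes a≤b = window-of-cover L≤t g∈W cover
    where
    a+L≡1+b : a + (suc b ∸ a) ≡ suc b
    a+L≡1+b = m+[n∸m]≡n (≤-trans a≤b (n≤1+n b))
    L≤t : suc b ∸ a ≤ t
    L≤t = ≤-trans (∸-monoʳ-≤ (suc b) (proj₁ (P-range (from (P⇔[a,b] a) (≤-refl , a≤b)))))
                  (proj₂ (P-range (from (P⇔[a,b] b) (a≤b , ≤-refl))))
    g∈W : ∀ j → InWindow t a (suc b ∸ a) (g j)
    g∈W j = let a≤gj , gj≤b = to (P⇔[a,b] (g j)) (from (P⇔image (g j)) (j , refl))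
            in inWindow a≤gj (subst (g j <_) (sym a+L≡1+b) (s≤s gj≤b)) mod-refl
    cover : ∀ k → k < suc b ∸ a → ∃ λ c → P c × c ≡ a + k mod t
    cover k k<L =
      a + k , from (P⇔[a,b] (a + k)) (m≤m+n a k , s≤s⁻¹ (subst (a + k <_) a+L≡1+b (+-monoʳ-< a k<L))) ,
      mod-refl

  -- The colours are [1, a] ∪ (b, t]; reading the first block as [t + 1, t + a] makes them the
  -- window (b, t + a] of length (t ∸ b) + a.
  gap-window : ∀ {a b} → a ≤ b → b ≤ t → (∀ c → P c → c ≤ a ⊎ b < c) →
               (∀ c → 1 ≤ c → c ≤ t → c ≤ a ⊎ b < c → P c) → Window
  gap-window {a} {b} a≤b b≤t P⇒outside outside⇒P = window-of-cover L≤t g∈W cover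
    where
    L : ℕ
    L = (t ∸ b) + a
    1+b+L≡1+t+a : suc b + L ≡ suc (t + a)
    1+b+L≡1+t+a = cong suc (trans (sym (+-assoc b (t ∸ b) a)) (cong (_+ a) (m+[n∸m]≡n b≤t)))
    L≤t : L ≤ t
    L≤t = ≤-trans (+-monoʳ-≤ (t ∸ b) a≤b) (≤-reflexive (m∸n+n≡m b≤t))
    placed : ∀ {c} → 1 ≤ c → c ≤ t → c ≤ a ⊎ b < c → InWindow t (suc b) L c
    placed {c} 1≤c c≤t (inj₁ c≤a) =
      inWindow (≤-trans (s≤s b≤t) (+-monoˡ-≤ t 1≤c))
               (subst (c + t <_) (sym 1+b+L≡1+t+a)
                  (s≤s (≤-trans (+-monoˡ-≤ t c≤a) (≤-reflexive (+-comm a t)))))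
               (mod-sym (+t≡-mod c))
    placed {c} 1≤c c≤t (inj₂ b<c) =
      inWindow b<c (subst (c <_) (sym 1+b+L≡1+t+a) (s≤s (≤-trans c≤t (m≤m+n t a)))) mod-refl
    g∈W : ∀ j → InWindow t (suc b) L (g j)
    g∈W j = let Pgj = from (P⇔image (g j)) (j , refl) ; 1≤gj , gj≤t = P-range Pgj
            in placed 1≤gj gj≤t (P⇒outside (g j) Pgj)
    wrap : ∀ v → suc b ≤ v → v < suc (t + a) → ∃ λ c → P c × c ≡ v mod t
    wrap v 1+b≤v v<1+t+a with v ≤? t
    ... | yes v≤t = v , outside⇒P v (≤-trans (s≤s z≤n) 1+b≤v) v≤t (inj₂ 1+b≤v) , mod-refl
    ... | no v≰t =
      let d , 1+t+d≡v = m≤n⇒∃[o]m+o≡n (≰⇒> v≰t)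
          d<a = +-cancelˡ-< t d a (s≤s⁻¹ (subst (_< suc (t + a)) (sym 1+t+d≡v) v<1+t+a))
      in suc d , outside⇒P (suc d) (s≤s z≤n) (≤-trans d<a (≤-trans a≤b b≤t)) (inj₁ d<a) ,
         mod-trans (mod-sym (+t≡-mod (suc d))) (≡⇒≡-mod (trans (cong suc (+-comm d t)) 1+t+d≡v))
    cover : ∀ k → k < L → ∃ λ c → P c × c ≡ suc b + k mod t
    cover k k<L =
      wrap (suc b + k) (m≤m+n (suc b) k) (subst (suc b + k <_) 1+b+L≡1+t+a (+-monoʳ-< (suc b) k<L))

  full-window : (∀ c → 1 ≤ c → c ≤ t → P c) → Window
  full-window [1,t]⊆P =
    gap-window ≤-refl ≤-refl (λ c Pc → inj₁ (proj₂ (P-range Pc))) (λ c 1≤c c≤t _ → [1,t]⊆P c 1≤c c≤t)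

  Pᶜ : ℕ → Set
  Pᶜ c = (1 ≤ c × c ≤ t) × ¬ P c

  cointerval-window : ∀ a b → (∀ c → Pᶜ c ⇔ (a ≤ c × c ≤ b)) → Window
  cointerval-window zero b Pᶜ⇔[0,b] =
    contradiction (proj₁ (proj₁ (from (Pᶜ⇔[0,b] 0) (z≤n , z≤n)))) λ ()
  cointerval-window (suc a) b Pᶜ⇔[1+a,b] with a <? b
  ... | no a≮b = full-window λ c 1≤c c≤t → P-stable λ ¬Pc →
    let a<c , c≤b = to (Pᶜ⇔[1+a,b] c) ((1≤c , c≤t) , ¬Pc) in a≮b (<-≤-trans a<c c≤b)
  ... | yes a<b = gap-window (<⇒≤ a<b) b≤t P⇒outside outside⇒P
    where
    b≤t : b ≤ t
    b≤t = proj₂ (proj₁ (from (Pᶜ⇔[1+a,b] b) (a<b , ≤-refl)))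
    P⇒outside : ∀ c → P c → c ≤ a ⊎ b < c
    P⇒outside c Pc with c ≤? a | b <? c
    ... | yes c≤a | _       = inj₁ c≤a
    ... | no _    | yes b<c = inj₂ b<c
    ... | no c≰a  | no b≮c  = contradiction Pc (proj₂ (from (Pᶜ⇔[1+a,b] c) (≰⇒> c≰a , ≮⇒≥ b≮c)))
    excluded : ∀ {c} → c ≤ a ⊎ b < c → ¬ (suc a ≤ c × c ≤ b)
    excluded (inj₁ c≤a) (a<c , _) = <⇒≱ a<c c≤a
    excluded (inj₂ b<c) (_ , c≤b) = <⇒≱ b<c c≤b
    outside⇒P : ∀ c → 1 ≤ c → c ≤ t → c ≤ a ⊎ b < c → P c
    outside⇒P c 1≤c c≤t outside =
      P-stable λ ¬Pc → excluded outside (to (Pᶜ⇔[1+a,b] c) ((1≤c , c≤t) , ¬Pc))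

  window : Consecutive P ⊎ Consecutive Pᶜ → Window
  window (inj₁ (inj₁ ∅))             = empty-window ∅
  window (inj₁ (inj₂ (a , b , P⇔)))  = interval-window a b P⇔
  window (inj₂ (inj₁ ∅))             =
    full-window λ c 1≤c c≤t → P-stable λ ¬Pc → ∅ c ((1≤c , c≤t) , ¬Pc)
  window (inj₂ (inj₂ (a , b , Pᶜ⇔))) = cointerval-window a b Pᶜ⇔

module _ (G : Multigraph) {t : ℕ} {α : E G → ℕ} where

  edge-window : CyclicIntervalColoring G t α → ∀ {n} v (g : Fin n → E G) →
                (∀ j → Incident G (g j) v) → (∀ e → Incident G e v → ∃ λ j → g j ≡ e) →
                ∃ λ o → ∀ j → InWindow t o n (α (g j))
  edge-window ((α-range , _) , cyclic) v g incident cover =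
    ColourWindow.window (α ∘ g) (α-range ∘ g) (S G v α) S⇔image (cyclic v)
    where
    S⇔image : ∀ c → S G v α c ⇔ ∃ λ j → α (g j) ≡ c
    S⇔image c = mk⇔
      (λ (e , e∼v , αe≡c) → let j , gj≡e = cover e e∼v in j , trans (cong α gj≡e) αe≡c)
      (λ (j , αgj≡c) → g j , incident j , αgj≡c)

  proper-injective : ProperEdgeColoring G t α → DecidableEquality (E G) →
                     ∀ {e e' v} → Incident G e v → Incident G e' v → α e ≡ α e' → e ≡ e'
  proper-injective (_ , proper) _≟ₑ_ {e} {e'} {v} e∼v e'∼v αe≡αe' with e ≟ₑ e'
  ... | yes e≡e' = e≡e'
  ... | no e≢e'  = contradiction αe≡αe' (proper e e' v e≢e' e∼v e'∼v)

module _ {p q : ℕ} where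

  HE-≡-dec : DecidableEquality (HE p q)
  HE-≡-dec = Sum.≡-dec (Product.≡-dec Fin._≟_ Fin._≟_) Fin._≟_

  y-edge : Fin q → Fin (suc p) → HE p q
  y-edge i fzero    = inj₂ i
  y-edge i (fsuc k) = inj₁ (i , k)

  y-edge-incident : ∀ i j → Incident (H p q) (y-edge i j) (y i)
  y-edge-incident i fzero    = inj₁ refl
  y-edge-incident i (fsuc k) = inj₂ refl

  y-edges-cover : ∀ i e → Incident (H p q) e (y i) → ∃ λ j → y-edge i j ≡ e
  y-edges-cover i (inj₁ (i , k)) (inj₂ refl) = fsuc k , refl
  y-edges-cover i (inj₂ i)       (inj₁ refl) = fzero , refl
  y-edges-cover i (inj₁ _)       (inj₁ ())
  y-edges-cover i (inj₂ _)       (inj₂ ())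

  z-edges-cover : ∀ e → Incident (H p q) e z → ∃ λ i → inj₂ i ≡ e
  z-edges-cover (inj₂ i) (inj₂ refl) = i , refl
  z-edges-cover (inj₁ _) (inj₁ ())
  z-edges-cover (inj₁ _) (inj₂ ())
  z-edges-cover (inj₂ _) (inj₁ ())

proposition2 : (p q : ℕ) → 1 ≤ p → 1 ≤ q → 2 * p + q < p * q →
    (t : ℕ) → 1 ≤ t →
    ¬ (∃ λ (α : E (H p q) → ℕ) → CyclicIntervalColoring (H p q) t α)
proposition2 p q _ _ 2p+q<pq t _ (α , colouring@((α-range , _) , _)) = <⇒≱ 2p+q<pq (begin
    p * q          ≡⟨ *-comm p q ⟩
    q * p          ≤⟨ window-capacity x-colour x-colours-distinct x-window ⟩
    p + p + q      ≡⟨ cong (λ m → p + m + q) (+-identityʳ p) ⟨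
    2 * p + q      ∎)
  where
  open ≤-Reasoning
  z-window : ∃ λ o → ∀ i → InWindow t o q (α (inj₂ i))
  z-window = edge-window (H p q) colouring z inj₂ (λ _ → inj₂ refl) z-edges-cover
  y-window : ∀ i → ∃ λ o → ∀ j → InWindow t o (suc p) (α (y-edge i j))
  y-window i = edge-window (H p q) colouring (y i) (y-edge i) (y-edge-incident i) (y-edges-cover i)
  remQuot-injective : Injective _≡_ _≡_ (remQuot {q} p)
  remQuot-injective = Injection.injective (↔⇒↣ Fin.*↔×)
  x-edge : Fin (q * p) → HE p q
  x-edge = inj₁ ∘ remQuot p
  x-colour : Fin (q * p) → ℕ
  x-colour w = p + α (x-edge w)
  x-window : ∀ w → InWindow t (proj₁ z-window) (p + p + q) (x-colour w)
  x-window w = let i , k = remQuot p w ; _ , y∈W = y-window i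
               in path-window (y∈W (fsuc k)) (y∈W fzero) (proj₂ z-window i)
  colours-≡-mod⇒≡ : ∀ e e' → α e ≡ α e' mod t → α e ≡ α e'
  colours-≡-mod⇒≡ e e' = let 1≤αe , αe≤t = α-range e ; 1≤αe' , αe'≤t = α-range e'
                         in ≡-mod⇒≡ 1≤αe (s≤s αe≤t) 1≤αe' (s≤s αe'≤t)
  x-colours-distinct : ∀ {w w'} → x-colour w ≡ x-colour w' mod t → w ≡ w'
  x-colours-distinct {w} {w'} eq = remQuot-injective (Sum.inj₁-injective
    (proper-injective (H p q) (proj₁ colouring) HE-≡-dec (inj₁ refl) (inj₁ refl)
      (colours-≡-mod⇒≡ (x-edge w) (x-edge w') (+-cancelˡ-mod p eq))))
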